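{- Let $A$ be a $\{ -,\triangleright\}$-algebra. If $A$ is completely representable by partial functions, then $A$ is atomic.
   Context: On partial functions, $f-g=\{(x,y)\in f\mid (x,y)\notin g\}$ and $f\triangleright g=\{(x,y)\in g\mid x\in\mathrm{dom}(f)\}$. A representation of $A$ by partial functions is an isomorphism $\theta$ onto a set of partial functions on a base $X$ closed under these operations, viewed as a map into the poset of all partial functions on $X$ under inclusion. In $A$ write $a\cdot b:=a-(a-b)$, $a\le b\iff a\cdot b=a$, least element $0=a-a$. $\theta$ is complete if for every nonempty $S\subseteq A$ whose meet exists, $\theta(\bigwedge S)=\bigcap\theta[S]$, and for every $S\subseteq A$ whose join exists, $\bigcup\theta[S]$ is a partial function equal to $\theta(\bigvee S)$ (equivalent conditions). $A$ is completely representable if it has a complete representation. An atom is a minimal nonzero element; $A$ is atomic if every nonzero element is above an atom. -}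

module Defs where

open import Data.Product using (Σ; ∃; _×_; _,_)
open import Relation.Binary.PropositionalEquality using (_≡_; _≢_)
open import Relation.Nullary using (¬_)

record MinusRestrictAlg : Set₁ where
  field
    Carrier : Set
    _⊖_     : Carrier → Carrier → Carrier
    _▷_     : Carrier → Carrier → Carrier

-- Partial functions on a base X, as binary relations X → X → Set
-- (f x y means (x , y) ∈ f).

Rel : Set → Set₁
Rel X = X → X → Set

IsPartialFunction : {X : Set} → Rel X → Set
IsPartialFunction f = ∀ {x y z} → f x y → f x z → y ≡ z

_≐_ : {X : Set} → Rel X → Rel X → Set
f ≐ g = ∀ x y → (f x y → g x y) × (g x y → f x y)

dom : {X : Set} → Rel X → X → Set
dom f x = ∃ λ y → f x y

_−ᵣ_ : {X : Set} → Rel X → Rel X → Rel X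
(f −ᵣ g) x y = f x y × ¬ g x y

_▷ᵣ_ : {X : Set} → Rel X → Rel X → Rel X
(f ▷ᵣ g) x y = g x y × dom f x

⋃ᵣ : {I X : Set} → (I → Set) → (I → Rel X) → Rel X
⋃ᵣ S θ x y = ∃ λ s → S s × θ s x y

module _ (A : MinusRestrictAlg) where
  open MinusRestrictAlg A

  _·_ : Carrier → Carrier → Carrier
  a · b = a ⊖ (a ⊖ b)

  _≤A_ : Carrier → Carrier → Set
  a ≤A b = a · b ≡ a

  -- 0 = a - a ; "a is nonzero" means a ≠ a - a
  NonZero : Carrier → Set
  NonZero a = a ≢ a ⊖ a

  IsUpperBound : (Carrier → Set) → Carrier → Set
  IsUpperBound S j = ∀ s → S s → s ≤A j

  IsJoin : (Carrier → Set) → Carrier → Set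
  IsJoin S j = IsUpperBound S j × (∀ u → IsUpperBound S u → j ≤A u)

  record IsRepresentation {X : Set} (θ : Carrier → Rel X) : Set where
    field
      functional : ∀ a → IsPartialFunction (θ a)
      injective  : ∀ a b → θ a ≐ θ b → a ≡ b
      pres-⊖     : ∀ a b → θ (a ⊖ b) ≐ (θ a −ᵣ θ b)
      pres-▷     : ∀ a b → θ (a ▷ b) ≐ (θ a ▷ᵣ θ b)

  -- complete: every existing join is sent to the union
  -- (the union is then automatically a partial function, being equal to θ j)
  IsComplete : {X : Set} → (Carrier → Rel X) → Set₁
  IsComplete θ = ∀ (S : Carrier → Set) (j : Carrier) → IsJoin S j → θ j ≐ ⋃ᵣ S θ

  CompletelyRepresentable : Set₁
  CompletelyRepresentable =
    Σ Set λ X → Σ (Carrier → Rel X) λ θ → IsRepresentation θ × IsComplete θ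

  IsAtom : Carrier → Set
  IsAtom b = NonZero b × (∀ c → c ≤A b → NonZero c → c ≡ b)

  Atomic : Set
  Atomic = ∀ a → NonZero a → ∃ λ b → IsAtom b × b ≤A a

module Submission where

-- Fix a nonzero a and a pair (x , y) in θ a, and let S be the set of elements below a
-- whose image avoids (x , y). By completeness a cannot be the join of S, since the union
-- of θ[S] misses (x , y). Hence some upper bound u of S has a ⊖ u ≠ 0. Every nonzero
-- d ≤ a ⊖ u must contain (x , y), for otherwise d ∈ S and so d ≤ u, forcing θ d = ∅.
-- A nonzero element all of whose nonzero lower bounds contain a common pair is an atom:
-- for d below it, the difference with d avoids that pair, so it is zero.

open import Defs
open import Level using (0ℓ)
open import Axiom.ExcludedMiddle using (ExcludedMiddle)
open import Data.Product using (∃; ∃₂; _×_; _,_; proj₁; proj₂)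
open import Data.Empty using (⊥-elim)
open import Relation.Nullary using (¬_; yes; no)
open import Relation.Nullary.Decidable using (decidable-stable)
open import Relation.Binary.PropositionalEquality using (_≡_; subst; sym)

module Representation (lem : ExcludedMiddle 0ℓ) (A : MinusRestrictAlg) {X : Set}
  (θ : MinusRestrictAlg.Carrier A → Rel X) (R : IsRepresentation A θ) where
  open MinusRestrictAlg A
  open IsRepresentation R

  private
    _≤_ : Carrier → Carrier → Set
    _≤_ = _≤A_ A

  classical : {P : Set} → ¬ ¬ P → P
  classical = decidable-stable lem

  _⊆_ : Rel X → Rel X → Set
  f ⊆ g = ∀ {p q} → f p q → g p q

  ⊖-sound : ∀ c d {p q} → θ (c ⊖ d) p q → θ c p q × ¬ θ d p q
  ⊖-sound c d = proj₁ (pres-⊖ c d _ _)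

  ⊖-complete : ∀ c d {p q} → θ c p q → ¬ θ d p q → θ (c ⊖ d) p q
  ⊖-complete c d h n = proj₂ (pres-⊖ c d _ _) (h , n)

  zero-empty : ∀ c {p q} → ¬ θ (c ⊖ c) p q
  zero-empty c h = let (h∈c , h∉c) = ⊖-sound c c h in h∉c h∈c

  empty⇒zero : ∀ c → (∀ {p q} → ¬ θ c p q) → c ≡ c ⊖ c
  empty⇒zero c e = injective c (c ⊖ c) λ p q →
    (λ h → ⊥-elim (e h)) , (λ h → ⊥-elim (zero-empty c h))

  inhabited⇒NonZero : ∀ c {p q} → θ c p q → NonZero A c
  inhabited⇒NonZero c h c≡0 = zero-empty c (subst (λ z → θ z _ _) c≡0 h)

  NonZero⇒inhabited : ∀ c → NonZero A c → ∃₂ λ p q → θ c p q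
  NonZero⇒inhabited c nz = classical λ empty →
    nz (empty⇒zero c λ {p} {q} h → empty (p , q , h))

  ≤⇒⊆ : ∀ {c b} → c ≤ b → θ c ⊆ θ b
  ≤⇒⊆ {c} {b} c≤b {p} {q} h = classical λ h∉b →
    proj₂ (⊖-sound c (c ⊖ b) (subst (λ z → θ z p q) (sym c≤b) h)) (⊖-complete c b h h∉b)

  ⊆⇒≤ : ∀ c b → θ c ⊆ θ b → c ≤ b
  ⊆⇒≤ c b c⊆b = injective (c ⊖ (c ⊖ b)) c λ p q →
    (λ h → proj₁ (⊖-sound c (c ⊖ b) h)) ,
    (λ h → ⊖-complete c (c ⊖ b) h λ h′ → proj₂ (⊖-sound c b h′) (c⊆b h))

  ≤-trans : ∀ {c d e} → c ≤ d → d ≤ e → c ≤ e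
  ≤-trans {c} {d} {e} c≤d d≤e = ⊆⇒≤ c e λ h → ≤⇒⊆ d≤e (≤⇒⊆ c≤d h)

  ⊖-≤ : ∀ c d → (c ⊖ d) ≤ c
  ⊖-≤ c d = ⊆⇒≤ (c ⊖ d) c λ h → proj₁ (⊖-sound c d h)

  ≤⊖-and-≤⇒zero : ∀ {d c u} → d ≤ (c ⊖ u) → d ≤ u → d ≡ d ⊖ d
  ≤⊖-and-≤⇒zero {d} {c} {u} d≤c⊖u d≤u = empty⇒zero d λ h →
    proj₂ (⊖-sound c u (≤⇒⊆ d≤c⊖u h)) (≤⇒⊆ d≤u h)

  ConcentratedAt : X → X → Carrier → Set
  ConcentratedAt x y c = ∀ d → d ≤ c → NonZero A d → θ d x y

  concentrated⇒atom : ∀ {x y c} → NonZero A c → ConcentratedAt x y c → IsAtom A c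
  concentrated⇒atom {c = c} nz conc = nz , λ d d≤c nzd →
    injective d c λ p q → ≤⇒⊆ d≤c , c⊆d d d≤c nzd
    where
    c⊆d : ∀ d → d ≤ c → NonZero A d → θ c ⊆ θ d
    c⊆d d d≤c nzd h = classical λ h∉d →
      let c⊖d∋xy = conc (c ⊖ d) (⊖-≤ c d) (inhabited⇒NonZero (c ⊖ d) (⊖-complete c d h h∉d))
      in proj₂ (⊖-sound c d c⊖d∋xy) (conc d d≤c nzd)

  Avoiders : Carrier → X → X → Carrier → Set
  Avoiders a x y d = d ≤ a × ¬ θ d x y

  upperBound⇒⊖-concentrated : ∀ {a x y u} → IsUpperBound A (Avoiders a x y) u →
                              ConcentratedAt x y (a ⊖ u)
  upperBound⇒⊖-concentrated {a} {u = u} ub d d≤a⊖u nzd = classical λ d∌xy →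
    nzd (≤⊖-and-≤⇒zero d≤a⊖u (ub d (≤-trans d≤a⊖u (⊖-≤ a u) , d∌xy)))

  isJoin-avoiders : ∀ {a x y} →
                    (∀ u → IsUpperBound A (Avoiders a x y) u → ¬ NonZero A (a ⊖ u)) →
                    IsJoin A (Avoiders a x y) a
  isJoin-avoiders {a} no-gap = (λ d → proj₁) , λ u ub → ⊆⇒≤ a u λ h → classical λ h∉u →
    no-gap u ub (inhabited⇒NonZero (a ⊖ u) (⊖-complete a u h h∉u))

  module _ (C : IsComplete A θ) where

    ¬isJoin-avoiders : ∀ {a x y} → θ a x y → ¬ IsJoin A (Avoiders a x y) a
    ¬isJoin-avoiders {a} {x} {y} a∋xy join
      with proj₁ (C (Avoiders a x y) a join x y) a∋xy
    ... | d , (_ , d∌xy) , d∋xy = d∌xy d∋xy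

    atom-below : ∀ a → NonZero A a → ∃ λ b → IsAtom A b × b ≤ a
    atom-below a nz with NonZero⇒inhabited a nz
    ... | x , y , a∋xy with lem {∃ λ u → IsUpperBound A (Avoiders a x y) u × NonZero A (a ⊖ u)}
    ...   | yes (u , ub , nz-gap) =
            a ⊖ u , concentrated⇒atom nz-gap (upperBound⇒⊖-concentrated ub) , ⊖-≤ a u
    ...   | no no-gap =
            ⊥-elim (¬isJoin-avoiders a∋xy (isJoin-avoiders λ u ub nz-gap → no-gap (u , ub , nz-gap)))

corollary6p11 : ExcludedMiddle 0ℓ → (A : MinusRestrictAlg) → CompletelyRepresentable A → Atomic A
corollary6p11 lem A (X , θ , R , C) = Representation.atom-below lem A θ R C
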